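{- Let $m\ge 1$ and $n\ge 3$, and let $G=\times_m P_n$. For every corner vertex $v_c$ of $G$, $l(v_c)=-\frac{1}{2m+1}$.
   Context: $\times_m P_n$ is the Cartesian product of $m$ copies of the path $P_n$: its vertices are the $m$-tuples $(v_1,\dots,v_m)\in\{1,\dots,n\}^m$, and two vertices are adjacent iff they differ in exactly one coordinate, and there by exactly $1$. A corner vertex is one with all coordinates in $\{1,n\}$. For a vertex $v$ of positive degree, with neighborhood $N_v$, the leverage centrality is $l(v)=\frac{1}{\deg(v)}\sum_{w\in N_v}\frac{\deg(v)-\deg(w)}{\deg(v)+\deg(w)}$. -}

module Defs where

open import Data.Nat as ℕ using (ℕ; zero; suc; _+_; _*_; _∸_; ∣_-_∣)
open import Data.Fin using (Fin; toℕ)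
open import Data.Vec using (Vec; []; _∷_)
import Data.List
open Data.List using (List; []; _∷_; map; concatMap; filter; length; foldr)
open import Data.Integer using (ℤ; +_; _-_)
open import Data.Rational using (ℚ; _/_) renaming (_+_ to _+ℚ_; _*_ to _*ℚ_)
import Data.Rational as ℚ
open import Relation.Nullary using (Dec; yes; no)
open import Relation.Binary.PropositionalEquality using (_≡_)

import Data.Vec as Vec

-- Vertices of ×_m P_n : m-tuples with entries in Fin n
-- (Fin n index i represents the path vertex i+1 ∈ {1,…,n}).
Vertex : ℕ → ℕ → Set
Vertex m n = Vec (Fin n) m

allVertices : (m n : ℕ) → List (Vertex m n)
allVertices zero    n = [] ∷ []
allVertices (suc m) n =
  concatMap (λ a → map (a ∷_) (allVertices m n)) (Data.List.allFin n)

numDiff : {m n : ℕ} → Vertex m n → Vertex m n → ℕ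
numDiff []       []       = 0
numDiff (a ∷ v) (b ∷ w) with toℕ a ℕ.≟ toℕ b
... | yes _ = numDiff v w
... | no  _ = suc (numDiff v w)

totalDist : {m n : ℕ} → Vertex m n → Vertex m n → ℕ
totalDist []       []       = 0
totalDist (a ∷ v) (b ∷ w) = ∣ toℕ a - toℕ b ∣ + totalDist v w

Adjacent : {m n : ℕ} → Vertex m n → Vertex m n → Set
Adjacent v w = numDiff v w ≡ 1 Data.Product.× totalDist v w ≡ 1
  where import Data.Product

adjacent? : {m n : ℕ} → (v w : Vertex m n) → Dec (Adjacent v w)
adjacent? v w with numDiff v w ℕ.≟ 1 | totalDist v w ℕ.≟ 1
... | yes p | yes q = yes (p Data.Product., q) where import Data.Product
... | no ¬p | _     = no (λ r → ¬p (Data.Product.proj₁ r)) where import Data.Product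
... | yes _ | no ¬q = no (λ r → ¬q (Data.Product.proj₂ r)) where import Data.Product

neighbours : {m n : ℕ} → Vertex m n → List (Vertex m n)
neighbours {m} {n} v = filter (adjacent? v) (allVertices m n)

deg : {m n : ℕ} → Vertex m n → ℕ
deg v = length (neighbours v)

-- a / d as a rational, with the (never used here) convention a / 0 = 0
frac : ℤ → ℕ → ℚ
frac a zero    = ℚ.0ℚ
frac a (suc d) = a / suc d

leverage : {m n : ℕ} → Vertex m n → ℚ
leverage v =
  frac (+ 1) (deg v) *ℚ
  foldr _+ℚ_ ℚ.0ℚ
    (map (λ w → frac (+ deg v - + deg w) (deg v + deg w)) (neighbours v))

-- corner vertex: all coordinates in {1, n} (i.e. index 0 or n−1)
IsCorner : {m n : ℕ} → Vertex m n → Set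
IsCorner {n = n} v = Data.Vec.Relation.Unary.All.All
  (λ a → toℕ a ≡ 0 Data.Sum.⊎ toℕ a ≡ n ∸ 1) v
  where import Data.Vec.Relation.Unary.All ; import Data.Sum

-- The degree of a vertex of ×_m P_n is the sum over its coordinates of their degrees in P_n,
-- because two vertices are adjacent iff they agree in one coordinate and the rest are
-- adjacent, or they agree in the rest and that coordinate is adjacent in P_n.  An endpoint
-- of P_n has degree 1 and, for n ≥ 3, its unique neighbour has degree 2.  Hence a corner
-- has degree m and each of its m neighbours has degree m + 1, so every summand of l(v_c)
-- is (m − (m+1)) / (m + (m+1)) = −1/(2m+1) and so is their mean.
module Submission where

open import Defs
open import Data.Nat using (ℕ; suc; _≤_; _*_)
open import Data.Integer using (+_)
open import Data.Rational using (ℚ; _/_; -_)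
open import Relation.Binary.PropositionalEquality using (_≡_)

open import Data.Bool using (true; false; if_then_else_)
open import Data.Fin as Fin using (Fin; toℕ)
open import Data.Fin.Properties using (toℕ-injective; toℕ<n) renaming (_≟_ to _≟ᶠ_)
open import Data.Integer as ℤ using (_⊖_; -[1+_])
open import Data.Integer.Properties using ([1+m]⊖[1+n]≡m⊖n; pos-*; pos-+)
open import Data.Integer.Tactic.RingSolver using (solve-∀)
open import Data.List using (List; []; _∷_; _++_; map; concatMap; filter; length; foldr; allFin)
open import Data.List.Properties using (map-cong; map-++; map-∘; map-tabulate)
open import Data.List.Relation.Unary.All as All using (All; []; _∷_)
open import Data.List.Relation.Unary.All.Properties using (all-filter)
open import Data.Nat as ℕ using (zero; _+_; _<_; z≤n; s≤s; ∣_-_∣; _≟_)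
open import Data.Nat.ListAction using (sum)
open import Data.Nat.ListAction.Properties using (sum-++)
open import Data.Nat.Properties
  using (+-comm; +-suc; +-identityʳ; *-assoc; *-zeroʳ; *-distribˡ-+; +-commutativeSemigroup;
         m+n≡0⇒m≡0; m+n≡0⇒n≡0; ∣m-n∣≡0⇒m≡n; ∣n-n∣≡0; 0≢1+n; <-irrefl; ≤-refl)
open import Data.Product using (_×_; _,_; proj₂)
import Data.Rational as ℚ
open import Data.Rational using (mkℚ; 0ℚ; toℚᵘ)
open import Data.Rational.Properties using (toℚᵘ-injective; toℚᵘ-cong; toℚᵘ-homo-+; toℚᵘ-homo-*; toℚᵘ-fromℚᵘ)
open import Data.Rational.Unnormalised as ℚᵘ using (mkℚᵘ; *≡*) renaming (_≃_ to _≃ᵘ_)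
open import Data.Rational.Unnormalised.Properties using (module ≃-Reasoning) renaming (+-cong to +ᵘ-cong; *-cong to *ᵘ-cong)
open import Data.Sum as Sum using (_⊎_; inj₁; inj₂; [_,_])
open import Data.Vec using ([]; _∷_)
open import Data.Vec.Properties using (≡-dec)
open import Data.Vec.Relation.Unary.All using ([]; _∷_)
open import Function using (_∘_; id)
open import Function.Bundles using (_⇔_; mk⇔; Equivalence)
open import Relation.Binary.Definitions using (DecidableEquality)
open import Relation.Binary.PropositionalEquality using (refl; sym; trans; cong; cong₂; subst; module ≡-Reasoning)
open import Relation.Nullary using (Dec; yes; no; does; ¬_; _×-dec_; _⊎-dec_)
open import Relation.Nullary.Negation using (contradiction)
open import Relation.Unary using (Decidable)
open import Algebra.Properties.CommutativeSemigroup +-commutativeSemigroup using (interchange)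

open ≡-Reasoning

private
  variable
    A B : Set
    m n r : ℕ

∑ : List A → (A → ℕ) → ℕ
∑ xs f = sum (map f xs)

∑-cong : (xs : List A) {f g : A → ℕ} → (∀ x → f x ≡ g x) → ∑ xs f ≡ ∑ xs g
∑-cong xs f≗g = cong sum (map-cong f≗g xs)

∑-zero : (xs : List A) → ∑ xs (λ _ → 0) ≡ 0
∑-zero []       = refl
∑-zero (_ ∷ xs) = ∑-zero xs

∑-+ : (xs : List A) (f g : A → ℕ) → ∑ xs (λ x → f x + g x) ≡ ∑ xs f + ∑ xs g
∑-+ []       f g = refl
∑-+ (x ∷ xs) f g = trans (cong (_+_ (f x + g x)) (∑-+ xs f g)) (interchange (f x) (g x) _ _)

∑-*ˡ : (xs : List A) (k : ℕ) (f : A → ℕ) → ∑ xs (λ x → k * f x) ≡ k * ∑ xs f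
∑-*ˡ []       k f = sym (*-zeroʳ k)
∑-*ˡ (x ∷ xs) k f = trans (cong (_+_ (k * f x)) (∑-*ˡ xs k f)) (sym (*-distribˡ-+ k (f x) _))

∑-map : (h : A → B) (xs : List A) (f : B → ℕ) → ∑ (map h xs) f ≡ ∑ xs (f ∘ h)
∑-map h xs f = cong sum (sym (map-∘ xs))

∑-concatMap : (g : A → List B) (xs : List A) (f : B → ℕ) →
              ∑ (concatMap g xs) f ≡ ∑ xs (λ x → ∑ (g x) f)
∑-concatMap g []       f = refl
∑-concatMap g (x ∷ xs) f = begin
  sum (map f (g x ++ concatMap g xs))         ≡⟨ cong sum (map-++ f (g x) _) ⟩
  sum (map f (g x) ++ map f (concatMap g xs)) ≡⟨ sum-++ (map f (g x)) _ ⟩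
  ∑ (g x) f + ∑ (concatMap g xs) f            ≡⟨ cong (_+_ (∑ (g x) f)) (∑-concatMap g xs f) ⟩
  ∑ (g x) f + ∑ xs (λ y → ∑ (g y) f)          ∎

∑-allFin-suc : ∀ n (f : Fin (suc n) → ℕ) → ∑ (allFin (suc n)) f ≡ f Fin.zero + ∑ (allFin n) (f ∘ Fin.suc)
∑-allFin-suc n f =
  cong (_+_ (f Fin.zero)) (cong sum (trans (map-tabulate Fin.suc f) (sym (map-tabulate id (f ∘ Fin.suc)))))

∑-allVertices-suc : (f : Vertex (suc m) n → ℕ) →
  ∑ (allVertices (suc m) n) f ≡ ∑ (allFin n) (λ b → ∑ (allVertices m n) (λ w → f (b ∷ w)))
∑-allVertices-suc {m} {n} f =
  trans (∑-concatMap _ (allFin n) f) (∑-cong (allFin n) (λ b → ∑-map (b ∷_) (allVertices m n) f))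

𝟙 : {P : Set} → Dec P → ℕ
𝟙 P? = if does P? then 1 else 0

length-filter≡∑𝟙 : {P : A → Set} (P? : Decidable P) (xs : List A) → length (filter P? xs) ≡ ∑ xs (𝟙 ∘ P?)
length-filter≡∑𝟙 P? []       = refl
length-filter≡∑𝟙 P? (x ∷ xs) with does (P? x)
... | true  = cong suc (length-filter≡∑𝟙 P? xs)
... | false = length-filter≡∑𝟙 P? xs

𝟙-cong : {P Q : Set} → P ⇔ Q → (P? : Dec P) (Q? : Dec Q) → 𝟙 P? ≡ 𝟙 Q?
𝟙-cong P⇔Q (yes p) (yes q) = refl
𝟙-cong P⇔Q (yes p) (no ¬q) = contradiction (Equivalence.to P⇔Q p) ¬q
𝟙-cong P⇔Q (no ¬p) (yes q) = contradiction (Equivalence.from P⇔Q q) ¬p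
𝟙-cong P⇔Q (no ¬p) (no ¬q) = refl

𝟙-× : {P Q : Set} (P? : Dec P) (Q? : Dec Q) → 𝟙 (P? ×-dec Q?) ≡ 𝟙 P? * 𝟙 Q?
𝟙-× (yes _) Q? = sym (+-identityʳ (𝟙 Q?))
𝟙-× (no _)  Q? = refl

𝟙-⊎ : {P Q : Set} → ¬ (P × Q) → (P? : Dec P) (Q? : Dec Q) → 𝟙 (P? ⊎-dec Q?) ≡ 𝟙 P? + 𝟙 Q?
𝟙-⊎ disjoint (yes p) (yes q) = contradiction (p , q) disjoint
𝟙-⊎ disjoint (yes _) (no _)  = refl
𝟙-⊎ disjoint (no _)  Q?      = refl

∑-allFin-𝟙≡ : (a : Fin n) (f : Fin n → ℕ) → ∑ (allFin n) (λ b → 𝟙 (a ≟ᶠ b) * f b) ≡ f a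
∑-allFin-𝟙≡ {suc n} Fin.zero f = begin
  ∑ (allFin (suc n)) (λ b → 𝟙 (Fin.zero ≟ᶠ b) * f b) ≡⟨ ∑-allFin-suc n (λ b → 𝟙 (Fin.zero ≟ᶠ b) * f b) ⟩
  f Fin.zero + 0 + ∑ (allFin n) (λ _ → 0)            ≡⟨ cong₂ _+_ (+-identityʳ _) (∑-zero (allFin n)) ⟩
  f Fin.zero + 0                                     ≡⟨ +-identityʳ _ ⟩
  f Fin.zero                                         ∎
∑-allFin-𝟙≡ {suc n} (Fin.suc a) f =
  trans (∑-allFin-suc n (λ b → 𝟙 (Fin.suc a ≟ᶠ b) * f b)) (∑-allFin-𝟙≡ a (f ∘ Fin.suc))

infix 4 _≟ᵛ_
_≟ᵛ_ : DecidableEquality (Vertex m n)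
_≟ᵛ_ = ≡-dec _≟ᶠ_

-- On conses, ≡-dec decides heads and tails jointly with ×-dec, so 𝟙-× splits its indicator.
∑-allVertices-𝟙≡ : (v : Vertex m n) (f : Vertex m n → ℕ) → ∑ (allVertices m n) (λ w → 𝟙 (v ≟ᵛ w) * f w) ≡ f v
∑-allVertices-𝟙≡ []       f = trans (+-identityʳ _) (+-identityʳ _)
∑-allVertices-𝟙≡ {suc m} {n} (a ∷ v) f = begin
  ∑ (allVertices (suc m) n) (λ u → 𝟙 (a ∷ v ≟ᵛ u) * f u)
    ≡⟨ ∑-allVertices-suc (λ u → 𝟙 (a ∷ v ≟ᵛ u) * f u) ⟩
  ∑ (allFin n) (λ b → ∑ (allVertices m n) (λ w → 𝟙 (a ∷ v ≟ᵛ b ∷ w) * f (b ∷ w)))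
    ≡⟨ ∑-cong (allFin n) (λ b → ∑-cong (allVertices m n) (λ w →
         trans (cong (_* f (b ∷ w)) (𝟙-× (a ≟ᶠ b) (v ≟ᵛ w))) (*-assoc (𝟙 (a ≟ᶠ b)) _ _))) ⟩
  ∑ (allFin n) (λ b → ∑ (allVertices m n) (λ w → 𝟙 (a ≟ᶠ b) * (𝟙 (v ≟ᵛ w) * f (b ∷ w))))
    ≡⟨ ∑-cong (allFin n) (λ b →
         trans (∑-*ˡ (allVertices m n) (𝟙 (a ≟ᶠ b)) (λ w → 𝟙 (v ≟ᵛ w) * f (b ∷ w)))
               (cong (𝟙 (a ≟ᶠ b) *_) (∑-allVertices-𝟙≡ v (f ∘ (b ∷_))))) ⟩
  ∑ (allFin n) (λ b → 𝟙 (a ≟ᶠ b) * f (b ∷ v))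
    ≡⟨ ∑-allFin-𝟙≡ a (λ b → f (b ∷ v)) ⟩
  f (a ∷ v) ∎

-- Degrees in the path P_n, whose vertices are numbered 0, 1, …, n − 1

pathDeg : ℕ → ℕ → ℕ
pathDeg n x = ∑ (allFin n) (λ b → 𝟙 (∣ x - toℕ b ∣ ≟ 1))

pathDeg-suc : ∀ n x → pathDeg (suc n) (suc x) ≡ 𝟙 (x ≟ 0) + pathDeg n x
pathDeg-suc n x = ∑-allFin-suc n _

pathDeg-first : ∀ n → pathDeg (suc (suc n)) 0 ≡ 1
pathDeg-first n =
  trans (∑-allFin-suc (suc n) (λ b → 𝟙 (toℕ b ≟ 1)))
        (trans (∑-allFin-suc n (λ b → 𝟙 (suc (toℕ b) ≟ 1))) (cong suc (∑-zero (allFin n))))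

pathDeg-last : ∀ n → pathDeg (suc (suc n)) (suc n) ≡ 1
pathDeg-last zero    = pathDeg-suc 1 0
pathDeg-last (suc n) = trans (pathDeg-suc (suc (suc n)) (suc n)) (pathDeg-last n)

pathDeg-endpoint : ∀ {x} → x ≡ 0 ⊎ x ≡ suc n → pathDeg (suc (suc n)) x ≡ 1
pathDeg-endpoint {n} (inj₁ refl) = pathDeg-first n
pathDeg-endpoint {n} (inj₂ refl) = pathDeg-last n

pathDeg-interior : ∀ {x} → 2 + x < n → pathDeg n (suc x) ≡ 2
pathDeg-interior {suc (suc (suc n))} {zero} (s≤s (s≤s (s≤s _))) =
  trans (pathDeg-suc (suc (suc n)) 0) (cong suc (pathDeg-first n))
pathDeg-interior {suc (suc zero)} {zero} (s≤s (s≤s ()))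
pathDeg-interior {suc n} {suc x} (s≤s 2+x<n) = trans (pathDeg-suc n (suc x)) (pathDeg-interior 2+x<n)

∣m-n∣≡1⇒n≡1+m⊎m≡1+n : ∀ {m n} → ∣ m - n ∣ ≡ 1 → n ≡ suc m ⊎ m ≡ suc n
∣m-n∣≡1⇒n≡1+m⊎m≡1+n {zero}  {n}     eq = inj₁ eq
∣m-n∣≡1⇒n≡1+m⊎m≡1+n {suc m} {zero}  eq = inj₂ eq
∣m-n∣≡1⇒n≡1+m⊎m≡1+n {suc m} {suc n} eq = Sum.map (cong suc) (cong suc) (∣m-n∣≡1⇒n≡1+m⊎m≡1+n eq)

pathDeg-beside-endpoint : ∀ {x y} → x ≡ 0 ⊎ x ≡ 2 + r → ∣ x - y ∣ ≡ 1 → y < 3 + r → pathDeg (3 + r) y ≡ 2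
pathDeg-beside-endpoint {r} {x} {y} end x~y y<n with ∣m-n∣≡1⇒n≡1+m⊎m≡1+n {x} {y} x~y | end
... | inj₁ refl | inj₁ refl = pathDeg-interior {3 + r} {0} (s≤s (s≤s (s≤s z≤n)))
... | inj₁ refl | inj₂ refl = contradiction y<n (<-irrefl refl)
... | inj₂ refl | inj₂ refl = pathDeg-interior {3 + r} {r} ≤-refl

numDiff-refl : (v : Vertex m n) → numDiff v v ≡ 0
numDiff-refl []      = refl
numDiff-refl (a ∷ v) with toℕ a ≟ toℕ a
... | yes _   = numDiff-refl v
... | no a≢a  = contradiction refl a≢a

totalDist-refl : (v : Vertex m n) → totalDist v v ≡ 0
totalDist-refl []      = refl
totalDist-refl (a ∷ v) = cong₂ _+_ (∣n-n∣≡0 (toℕ a)) (totalDist-refl v)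

totalDist≡0⇒≡ : {v w : Vertex m n} → totalDist v w ≡ 0 → v ≡ w
totalDist≡0⇒≡ {v = []}    {[]}    _   = refl
totalDist≡0⇒≡ {v = a ∷ v} {b ∷ w} d≡0 =
  cong₂ _∷_ (toℕ-injective (∣m-n∣≡0⇒m≡n (m+n≡0⇒m≡0 _ d≡0))) (totalDist≡0⇒≡ (m+n≡0⇒n≡0 _ d≡0))

m≢0∧m+n≡1⇒m≡1∧n≡0 : ∀ {m n} → ¬ m ≡ 0 → m + n ≡ 1 → m ≡ 1 × n ≡ 0
m≢0∧m+n≡1⇒m≡1∧n≡0 {zero}     m≢0 _    = contradiction refl m≢0
m≢0∧m+n≡1⇒m≡1∧n≡0 {suc zero} _   refl = refl , refl

adjacent-∷ : (a b : Fin n) (v w : Vertex m n) →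
  Adjacent (a ∷ v) (b ∷ w) ⇔ ((a ≡ b × Adjacent v w) ⊎ (v ≡ w × ∣ toℕ a - toℕ b ∣ ≡ 1))
adjacent-∷ a b v w with toℕ a ≟ toℕ b
... | yes a≡b with refl ← toℕ-injective a≡b rewrite ∣n-n∣≡0 (toℕ a) =
  mk⇔ (inj₁ ∘ (refl ,_)) [ proj₂ , (λ ()) ∘ proj₂ ]
... | no a≢b = mk⇔ to from
  where
  to : suc (numDiff v w) ≡ 1 × ∣ toℕ a - toℕ b ∣ + totalDist v w ≡ 1 →
       (a ≡ b × Adjacent v w) ⊎ (v ≡ w × ∣ toℕ a - toℕ b ∣ ≡ 1)
  to (_ , sum≡1) with d≡1 , t≡0 ← m≢0∧m+n≡1⇒m≡1∧n≡0 (a≢b ∘ ∣m-n∣≡0⇒m≡n) sum≡1 =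
    inj₂ (totalDist≡0⇒≡ t≡0 , d≡1)
  from : (a ≡ b × Adjacent v w) ⊎ (v ≡ w × ∣ toℕ a - toℕ b ∣ ≡ 1) →
         suc (numDiff v w) ≡ 1 × ∣ toℕ a - toℕ b ∣ + totalDist v w ≡ 1
  from (inj₁ (refl , _))   = contradiction refl a≢b
  from (inj₂ (refl , d≡1)) = cong suc (numDiff-refl v) , cong₂ _+_ d≡1 (totalDist-refl v)

𝟙-adjacent-∷ : (a b : Fin n) (v w : Vertex m n) →
  𝟙 (adjacent? (a ∷ v) (b ∷ w)) ≡ 𝟙 (a ≟ᶠ b) * 𝟙 (adjacent? v w) + 𝟙 (v ≟ᵛ w) * 𝟙 (∣ toℕ a - toℕ b ∣ ≟ 1)
𝟙-adjacent-∷ a b v w = begin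
  𝟙 (adjacent? (a ∷ v) (b ∷ w))
    ≡⟨ 𝟙-cong (adjacent-∷ a b v w) (adjacent? (a ∷ v) (b ∷ w)) (same? ⊎-dec step?) ⟩
  𝟙 (same? ⊎-dec step?)
    ≡⟨ 𝟙-⊎ disjoint same? step? ⟩
  𝟙 same? + 𝟙 step?
    ≡⟨ cong₂ _+_ (𝟙-× (a ≟ᶠ b) (adjacent? v w)) (𝟙-× (v ≟ᵛ w) (∣ toℕ a - toℕ b ∣ ≟ 1)) ⟩
  𝟙 (a ≟ᶠ b) * 𝟙 (adjacent? v w) + 𝟙 (v ≟ᵛ w) * 𝟙 (∣ toℕ a - toℕ b ∣ ≟ 1) ∎
  where
  same? : Dec (a ≡ b × Adjacent v w)
  same? = a ≟ᶠ b ×-dec adjacent? v w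
  step? : Dec (v ≡ w × ∣ toℕ a - toℕ b ∣ ≡ 1)
  step? = v ≟ᵛ w ×-dec (∣ toℕ a - toℕ b ∣ ≟ 1)
  disjoint : ¬ ((a ≡ b × Adjacent v w) × (v ≡ w × ∣ toℕ a - toℕ b ∣ ≡ 1))
  disjoint ((refl , _) , (_ , d≡1)) = 0≢1+n (trans (sym (∣n-n∣≡0 (toℕ a))) d≡1)

deg-∷ : (a : Fin n) (v : Vertex m n) → deg (a ∷ v) ≡ pathDeg n (toℕ a) + deg v
deg-∷ {n} {m} a v = begin
  deg (a ∷ v)
    ≡⟨ length-filter≡∑𝟙 (adjacent? (a ∷ v)) (allVertices (suc m) n) ⟩
  ∑ (allVertices (suc m) n) (𝟙 ∘ adjacent? (a ∷ v))
    ≡⟨ ∑-allVertices-suc (𝟙 ∘ adjacent? (a ∷ v)) ⟩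
  ∑ (allFin n) (λ b → ∑ (allVertices m n) (λ w → 𝟙 (adjacent? (a ∷ v) (b ∷ w))))
    ≡⟨ ∑-cong (allFin n) row ⟩
  ∑ (allFin n) (λ b → 𝟙 (a ≟ᶠ b) * deg v + 𝟙 (∣ toℕ a - toℕ b ∣ ≟ 1))
    ≡⟨ ∑-+ (allFin n) _ _ ⟩
  ∑ (allFin n) (λ b → 𝟙 (a ≟ᶠ b) * deg v) + pathDeg n (toℕ a)
    ≡⟨ cong (_+ pathDeg n (toℕ a)) (∑-allFin-𝟙≡ a (λ _ → deg v)) ⟩
  deg v + pathDeg n (toℕ a)
    ≡⟨ +-comm (deg v) _ ⟩
  pathDeg n (toℕ a) + deg v ∎
  where
  Vs : List (Vertex m n)
  Vs = allVertices m n
  row : ∀ b → ∑ Vs (λ w → 𝟙 (adjacent? (a ∷ v) (b ∷ w))) ≡ 𝟙 (a ≟ᶠ b) * deg v + 𝟙 (∣ toℕ a - toℕ b ∣ ≟ 1)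
  row b = begin
    ∑ Vs (λ w → 𝟙 (adjacent? (a ∷ v) (b ∷ w)))
      ≡⟨ ∑-cong Vs (𝟙-adjacent-∷ a b v) ⟩
    ∑ Vs (λ w → 𝟙 (a ≟ᶠ b) * 𝟙 (adjacent? v w) + 𝟙 (v ≟ᵛ w) * 𝟙 (∣ toℕ a - toℕ b ∣ ≟ 1))
      ≡⟨ ∑-+ Vs _ _ ⟩
    ∑ Vs (λ w → 𝟙 (a ≟ᶠ b) * 𝟙 (adjacent? v w)) + ∑ Vs (λ w → 𝟙 (v ≟ᵛ w) * 𝟙 (∣ toℕ a - toℕ b ∣ ≟ 1))
      ≡⟨ cong₂ _+_ (∑-*ˡ Vs (𝟙 (a ≟ᶠ b)) (𝟙 ∘ adjacent? v)) (∑-allVertices-𝟙≡ v (λ _ → 𝟙 (∣ toℕ a - toℕ b ∣ ≟ 1))) ⟩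
    𝟙 (a ≟ᶠ b) * ∑ Vs (𝟙 ∘ adjacent? v) + 𝟙 (∣ toℕ a - toℕ b ∣ ≟ 1)
      ≡⟨ cong (λ k → 𝟙 (a ≟ᶠ b) * k + 𝟙 (∣ toℕ a - toℕ b ∣ ≟ 1)) (sym (length-filter≡∑𝟙 (adjacent? v) Vs)) ⟩
    𝟙 (a ≟ᶠ b) * deg v + 𝟙 (∣ toℕ a - toℕ b ∣ ≟ 1) ∎

deg-corner : {v : Vertex m (2 + r)} → IsCorner v → deg v ≡ m
deg-corner {v = []}    []                  = refl
deg-corner {v = a ∷ v} (a-end ∷ v-corner) =
  trans (deg-∷ a v) (cong₂ _+_ (pathDeg-endpoint a-end) (deg-corner v-corner))

deg-adjacent-corner : {v w : Vertex m (3 + r)} → IsCorner v → Adjacent v w → deg w ≡ suc m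
deg-adjacent-corner {v = []}    {[]}    []                 (() , _)
deg-adjacent-corner {v = a ∷ v} {b ∷ w} (a-end ∷ v-corner) adj with Equivalence.to (adjacent-∷ a b v w) adj
... | inj₁ (refl , v~w) =
  trans (deg-∷ a w) (cong₂ _+_ (pathDeg-endpoint a-end) (deg-adjacent-corner v-corner v~w))
... | inj₂ (refl , a~b) =
  trans (deg-∷ b v) (cong₂ _+_ (pathDeg-beside-endpoint a-end a~b (toℕ<n b)) (deg-corner v-corner))

-- Computing in ℚᵘ sidesteps the gcd normalisation of ℚ, which is stuck on open terms.
toℚᵘ-sum-constant : {f : A → ℚ} {c : ℚ} (xs : List A) → All (λ x → f x ≡ c) xs →
  toℚᵘ (foldr ℚ._+_ 0ℚ (map f xs)) ≃ᵘ mkℚᵘ (+ length xs ℤ.* ℚ.numerator c) (ℚ.denominator-1 c)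
toℚᵘ-sum-constant {c = mkℚ p q _} []       []            = *≡* refl
toℚᵘ-sum-constant {f = f} {c = mkℚ p q _} (x ∷ xs) (fx≡c ∷ fxs≡c) = begin-≃
  toℚᵘ (f x ℚ.+ foldr ℚ._+_ 0ℚ (map f xs))           ≈⟨ toℚᵘ-homo-+ (f x) _ ⟩
  toℚᵘ (f x) ℚᵘ.+ toℚᵘ (foldr ℚ._+_ 0ℚ (map f xs))   ≈⟨ +ᵘ-cong (toℚᵘ-cong fx≡c) (toℚᵘ-sum-constant xs fxs≡c) ⟩
  mkℚᵘ p q ℚᵘ.+ mkℚᵘ (+ k ℤ.* p) q                   ≈⟨ *≡* eq ⟩
  mkℚᵘ (+ suc k ℤ.* p) q                             ∎≃
  where
  open ≃-Reasoning renaming (begin_ to begin-≃_; _∎ to _∎≃)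
  k D : ℕ
  k = length xs
  D = suc q
  ring : ∀ a d j → (a ℤ.* d ℤ.+ (j ℤ.* a) ℤ.* d) ℤ.* d ≡ ((+ 1 ℤ.+ j) ℤ.* a) ℤ.* (d ℤ.* d)
  ring = solve-∀
  eq : (p ℤ.* + D ℤ.+ (+ k ℤ.* p) ℤ.* + D) ℤ.* + D ≡ (+ suc k ℤ.* p) ℤ.* + (D ℕ.* D)
  eq rewrite pos-* D D | pos-+ 1 k = ring p (+ D) (+ k)

mean-constant : {f : A → ℚ} {c : ℚ} (xs : List A) → 0 < length xs → All (λ x → f x ≡ c) xs →
  frac (+ 1) (length xs) ℚ.* foldr ℚ._+_ 0ℚ (map f xs) ≡ c
mean-constant {f = f} {c = mkℚ p q _} xs@(_ ∷ xs′) _ fxs≡c = toℚᵘ-injective (begin-≃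
  toℚᵘ (frac (+ 1) k ℚ.* S)                          ≈⟨ toℚᵘ-homo-* (frac (+ 1) k) S ⟩
  toℚᵘ (frac (+ 1) k) ℚᵘ.* toℚᵘ S                    ≈⟨ *ᵘ-cong (toℚᵘ-fromℚᵘ (mkℚᵘ (+ 1) (length xs′)))
                                                                (toℚᵘ-sum-constant xs fxs≡c) ⟩
  mkℚᵘ (+ 1) (length xs′) ℚᵘ.* mkℚᵘ (+ k ℤ.* p) q    ≈⟨ *≡* eq ⟩
  mkℚᵘ p q                                           ∎≃)
  where
  open ≃-Reasoning renaming (begin_ to begin-≃_; _∎ to _∎≃)
  k D : ℕ
  k = length xs
  D = suc q
  S : ℚ
  S = foldr ℚ._+_ 0ℚ (map f xs)
  ring : ∀ a d j → (+ 1 ℤ.* (j ℤ.* a)) ℤ.* d ≡ a ℤ.* (j ℤ.* d)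
  ring = solve-∀
  eq : (+ 1 ℤ.* (+ k ℤ.* p)) ℤ.* + D ≡ p ℤ.* + (k ℕ.* D)
  eq rewrite pos-* k D = ring p (+ D) (+ k)

m⊖1+m≡-1 : ∀ d → d ⊖ suc d ≡ -[1+ 0 ]
m⊖1+m≡-1 zero    = refl
m⊖1+m≡-1 (suc d) = trans ([1+m]⊖[1+n]≡m⊖n d (suc d)) (m⊖1+m≡-1 d)

[d-[1+d]]/[d+[1+d]]≡-1/[1+2d] : ∀ d → frac (+ d ℤ.- + suc d) (d + suc d) ≡ - (+ 1 / suc (2 * d))
[d-[1+d]]/[d+[1+d]]≡-1/[1+2d] d = cong₂ frac (m⊖1+m≡-1 d) (trans (+-suc d d) (cong (λ e → suc (d + e)) (sym (+-identityʳ d))))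

leverage-of-uniform-neighbours : (v : Vertex m n) {e : ℕ} → 0 < deg v → (∀ {w} → Adjacent v w → deg w ≡ e) →
  leverage v ≡ frac (+ deg v ℤ.- + e) (deg v + e)
leverage-of-uniform-neighbours {m} {n} v 0<deg deg-nbr = mean-constant (neighbours v) 0<deg
  (All.map (cong (λ d → frac (+ deg v ℤ.- + d) (deg v + d)) ∘ deg-nbr) (all-filter (adjacent? v) (allVertices m n)))

mainTheorem6 : (m n : ℕ) → 1 ≤ m → 3 ≤ n →
    (v : Vertex m n) → IsCorner v →
    leverage v ≡ - ((+ 1) / suc (2 * m))
mainTheorem6 (suc m) (suc (suc (suc r))) (s≤s z≤n) (s≤s (s≤s (s≤s z≤n))) v corner = begin
  leverage v
    ≡⟨ leverage-of-uniform-neighbours v (subst (0 <_) (sym deg-v) (s≤s z≤n)) (deg-adjacent-corner corner) ⟩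
  frac (+ deg v ℤ.- + suc (suc m)) (deg v + suc (suc m))
    ≡⟨ cong (λ d → frac (+ d ℤ.- + suc (suc m)) (d + suc (suc m))) deg-v ⟩
  frac (+ suc m ℤ.- + suc (suc m)) (suc m + suc (suc m))
    ≡⟨ [d-[1+d]]/[d+[1+d]]≡-1/[1+2d] (suc m) ⟩
  - (+ 1 / suc (2 * suc m)) ∎
  where
  deg-v : deg v ≡ suc m
  deg-v = deg-corner corner
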